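{- Let $N$ be a DC $X$-network and let $N'$ be a cluster-preserving simplification of $N$. Then (1) $N'$ is a DC $X$-network; (2) for each $v\in V(N')$ there is a unique vertex $\phi(v)\in V(N)$ with $cl(\phi(v);N)=cl(v;N')$; (3) if $(u,v)$ is an arc of $N'$, then there is a directed path from $\phi(u)$ to $\phi(v)$ in $N$; (4) if $u,v\in V(N')$ and there is a directed path from $\phi(u)$ to $\phi(v)$ in $N$, then there is a directed path from $u$ to $v$ in $N'$; (5) for vertices $u,w$ of $N'$, $\phi(u)<\phi(w)$ in $N$ iff $u<w$ in $N'$.
   Context: An $X$-network $N=(V,E,r,X)$ is a finite directed graph (no loops, no multiple arcs) that is acyclic, has a root $r$ (every vertex reachable from $r$ by a directed path), and whose leaves (out-degree $0$) are identified bijectively with $X$. Directed paths may have length $0$; $u<w$ means there is a directed path from $u$ to $w$ and $u\neq w$. The cluster of $v$ is $cl(v;N)=\{x\in X:\text{there is a directed path from } v\text{ to } x\}$; $N$ is distinct-cluster (DC) if distinct vertices have distinct clusters. An arc $(a,b)$ is redundant if there is a directed path from $a$ to $b$ of length greater than $1$. For a vertex $v\neq r$, $v\notin X$ with parents $q_1,\dots,q_k$ and children $c_1,\dots,c_m$, $D(v)N$ deletes $v$ and its incident arcs and adds arcs $(q_i,c_j)$ for all $i,j$ (no duplicates); for a redundant arc $(a,b)$, $D(a,b)N$ deletes that arc. A DC $X$-network $N'$ is a cluster-preserving simplification (CPS) of $N$ if there is a sequence $N=N_0,\dots,N_k=N'$ ($k\ge0$) of DC $X$-networks with each $N_{i+1}=D(v)N_i$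 for a non-root non-leaf vertex $v$ of $N_i$ or $N_{i+1}=D(a,b)N_i$ for a redundant arc $(a,b)$ of $N_i$. -}

module Defs where

open import Data.Nat using (ℕ)
open import Data.Product using (Σ; ∃; _×_; _,_)
open import Data.Sum using (_⊎_)
open import Data.List using (List)
open import Data.List.Membership.Propositional using (_∈_)
open import Relation.Nullary using (¬_)
open import Relation.Binary.PropositionalEquality using (_≡_; _≢_)
open import Relation.Binary.Construct.Closure.ReflexiveTransitive using (Star)
open import Relation.Binary.Construct.Closure.Transitive using (TransClosure)
open import Function.Bundles using (_⇔_)

-- A (candidate) X-network: vertices are named by natural numbers; the
-- vertex set is a predicate, the arc set a relation (so there are no
-- multiple arcs by construction), `root` is the root and `leaf x` is the
-- vertex identified with x ∈ X.  Vertex names are kept by the reductions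
-- D(v) and D(a,b), as in the paper (V(D(v)N) = V(N) ∖ {v}).
record Net (X : Set) : Set₁ where
  field
    vert : ℕ → Set
    arc  : ℕ → ℕ → Set
    root : ℕ
    leaf : X → ℕ
open Net public

module _ {X : Set} (N : Net X) where

  Path : ℕ → ℕ → Set
  Path = Star (arc N)

  Path⁺ : ℕ → ℕ → Set
  Path⁺ = TransClosure (arc N)

  _<ₙ_ : ℕ → ℕ → Set
  u <ₙ w = Path u w × u ≢ w

  cl : ℕ → X → Set
  cl v x = Path v (leaf N x)

  SameCl : ℕ → ℕ → Set
  SameCl u v = ∀ x → cl u x ⇔ cl v x

  IsLeafVertex : ℕ → Set
  IsLeafVertex v = vert N v × (∀ w → ¬ arc N v w)

  record IsXNetwork : Set where
    field
      finite     : Σ (List ℕ) λ l → ∀ v → vert N v → v ∈ l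
      arc-vert   : ∀ a b → arc N a b → vert N a × vert N b
      no-loops   : ∀ a → ¬ arc N a a
      acyclic    : ∀ a → ¬ Path⁺ a a
      root-vert  : vert N (root N)
      rooted     : ∀ v → vert N v → Path (root N) v
      leaf-inj   : ∀ x y → leaf N x ≡ leaf N y → x ≡ y
      leaf-leaf  : ∀ x → IsLeafVertex (leaf N x)
      leaf-onto  : ∀ v → IsLeafVertex v → ∃ λ x → v ≡ leaf N x

  IsDC : Set
  IsDC = IsXNetwork × (∀ u v → vert N u → vert N v → SameCl u v → u ≡ v)

  Redundant : ℕ → ℕ → Set
  Redundant a b = arc N a b × Σ ℕ λ c → arc N a c × Path⁺ c b

  Dv : ℕ → Net X
  Dv v = record
    { vert = λ u → vert N u × u ≢ v
    ; arc  = λ a b → (arc N a b × a ≢ v × b ≢ v) ⊎ (arc N a v × arc N v b)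
    ; root = root N
    ; leaf = leaf N
    }

  Darc : ℕ → ℕ → Net X
  Darc a b = record
    { vert = vert N
    ; arc  = λ c d → arc N c d × ¬ (c ≡ a × d ≡ b)
    ; root = root N
    ; leaf = leaf N
    }

data CPS {X : Set} (N : Net X) : Net X → Set₁ where
  start : IsDC N → CPS N N
  stepV : ∀ {M} → CPS N M → (v : ℕ) → vert M v → v ≢ root M
        → (∀ x → v ≢ leaf M x) → IsDC (Dv M v) → CPS N (Dv M v)
  stepA : ∀ {M} → CPS N M → (a b : ℕ) → Redundant M a b
        → IsDC (Darc M a b) → CPS N (Darc M a b)

-- Every reduction D(v), D(a,b) keeps the names of the surviving vertices and
-- leaves, and it neither creates nor destroys a directed path between two
-- surviving vertices: D(v) only shortcuts paths through v, and a redundant arc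
-- (a,b) can be rerouted through the longer a–b path, which cannot use (a,b)
-- itself by acyclicity.  Hence along a cluster-preserving simplification every
-- vertex of N' is a vertex of N with the same reachability relation and so the
-- same cluster, and φ is the identity on vertex names.
module Submission where

open import Defs
open import Data.Nat using (ℕ; _≟_)
open import Data.Product using (Σ; _×_; _,_; proj₁)
open import Data.Sum using (inj₁; inj₂)
open import Relation.Nullary using (¬_; yes; no; contradiction)
open import Relation.Binary.PropositionalEquality using (_≡_; _≢_; refl; trans; subst)
open import Function.Bundles using (_⇔_; mk⇔; Equivalence)
open import Function.Construct.Identity using (⇔-id)
open import Function.Construct.Symmetry using (⇔-sym)
open import Function.Construct.Composition using (_⇔-∘_)
open import Relation.Binary.Construct.Closure.ReflexiveTransitive using (ε; _◅_; _◅◅_)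
open import Relation.Binary.Construct.Closure.Transitive using ([_]; _∷_; _∷ʳ_)

open IsXNetwork
open Equivalence using (to; from)

module _ {X : Set} (M : Net X) where

  path⁺⇒path : ∀ {a b} → Path⁺ M a b → Path M a b
  path⁺⇒path [ e ]    = e ◅ ε
  path⁺⇒path (e ∷ p) = e ◅ path⁺⇒path p

  Dv-path⇒path : ∀ {v u w} → Path (Dv M v) u w → Path M u w
  Dv-path⇒path ε                    = ε
  Dv-path⇒path (inj₁ (e , _) ◅ p)  = e ◅ Dv-path⇒path p
  Dv-path⇒path (inj₂ (e , f) ◅ p)  = e ◅ f ◅ Dv-path⇒path p

  path⇒Dv-path : (∀ a → ¬ arc M a a) → ∀ {v u w} → u ≢ v → w ≢ v
               → Path M u w → Path (Dv M v) u w
  path⇒Dv-path loopless u≢v w≢v ε = ε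
  path⇒Dv-path loopless {v} u≢v w≢v (_◅_ {j = a} e p) with a ≟ v
  ... | no a≢v = inj₁ (e , u≢v , a≢v) ◅ path⇒Dv-path loopless a≢v w≢v p
  path⇒Dv-path loopless u≢v w≢v (e ◅ ε) | yes refl = contradiction refl w≢v
  path⇒Dv-path loopless {v} u≢v w≢v (e ◅ _◅_ {j = a'} f p) | yes refl with a' ≟ v
  ... | yes refl = contradiction f (loopless v)
  ... | no a'≢v  = inj₂ (e , f) ◅ path⇒Dv-path loopless a'≢v w≢v p

  Darc-path⇒path : ∀ {a b u w} → Path (Darc M a b) u w → Path M u w
  Darc-path⇒path ε             = ε
  Darc-path⇒path ((e , _) ◅ p) = e ◅ Darc-path⇒path p

  -- No arc of such a path leaves a: it would close a cycle through a.
  descendant-path⇒Darc-path : (∀ s → ¬ Path⁺ M s s) → ∀ {a b s t}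
                            → Path⁺ M a s → Path M s t → Path (Darc M a b) s t
  descendant-path⇒Darc-path acyc a⇝s ε = ε
  descendant-path⇒Darc-path acyc {a} a⇝s (e ◅ p) =
    (e , λ { (refl , _) → acyc a a⇝s })
      ◅ descendant-path⇒Darc-path acyc (a⇝s ∷ʳ e) p

  path⇒Darc-path : (∀ s → ¬ Path⁺ M s s) → ∀ {a b} → Redundant M a b
                 → ∀ {u w} → Path M u w → Path (Darc M a b) u w
  path⇒Darc-path acyc red ε = ε
  path⇒Darc-path acyc {a} {b} red (_◅_ {i = x} {j = y} e p) with x ≟ a | y ≟ b
  ... | no x≢a | _ = (e , λ { (x≡a , _) → x≢a x≡a }) ◅ path⇒Darc-path acyc red p
  ... | yes _ | no y≢b = (e , λ { (_ , y≡b) → y≢b y≡b }) ◅ path⇒Darc-path acyc red p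
  path⇒Darc-path acyc {a} {b} red@(_ , c , a→c , c⇝b) (e ◅ p) | yes refl | yes refl =
    ((a→c , λ { (_ , refl) → acyc b c⇝b })
       ◅ descendant-path⇒Darc-path acyc [ a→c ] (path⁺⇒path c⇝b))
      ◅◅ path⇒Darc-path acyc red p

record Simplifies {X : Set} (N M : Net X) : Set where
  field
    vert⊆ : ∀ v → vert M v → vert N v
    leaf≡ : ∀ x → leaf M x ≡ leaf N x
    path⇔ : ∀ u w → vert M u → vert M w → Path N u w ⇔ Path M u w

open Simplifies

Simplifies-refl : ∀ {X} {N : Net X} → Simplifies N N
Simplifies-refl = record
  { vert⊆ = λ _ v∈ → v∈ ; leaf≡ = λ _ → refl ; path⇔ = λ _ _ _ _ → ⇔-id _ }

Simplifies-trans : ∀ {X} {N M K : Net X} → Simplifies N M → Simplifies M K → Simplifies N K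
Simplifies-trans NM MK = record
  { vert⊆ = λ v v∈ → vert⊆ NM v (vert⊆ MK v v∈)
  ; leaf≡ = λ x → trans (leaf≡ MK x) (leaf≡ NM x)
  ; path⇔ = λ u w u∈ w∈ →
      path⇔ MK u w u∈ w∈ ⇔-∘ path⇔ NM u w (vert⊆ MK u u∈) (vert⊆ MK w w∈)
  }

Simplifies-Dv : ∀ {X} {M : Net X} → IsXNetwork M → ∀ v → Simplifies M (Dv M v)
Simplifies-Dv {M = M} M-net v = record
  { vert⊆ = λ _ → proj₁
  ; leaf≡ = λ _ → refl
  ; path⇔ = λ u w (_ , u≢v) (_ , w≢v) →
      mk⇔ (path⇒Dv-path M (no-loops M-net) u≢v w≢v) (Dv-path⇒path M)
  }

Simplifies-Darc : ∀ {X} {M : Net X} → IsXNetwork M → ∀ {a b} → Redundant M a b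
                → Simplifies M (Darc M a b)
Simplifies-Darc {M = M} M-net red = record
  { vert⊆ = λ _ v∈ → v∈
  ; leaf≡ = λ _ → refl
  ; path⇔ = λ _ _ _ _ → mk⇔ (path⇒Darc-path M (acyclic M-net) red) (Darc-path⇒path M)
  }

CPS⇒IsDC : ∀ {X} {N M : Net X} → CPS N M → IsDC M
CPS⇒IsDC (start dc)             = dc
CPS⇒IsDC (stepV _ _ _ _ _ dc)   = dc
CPS⇒IsDC (stepA _ _ _ _ dc)     = dc

CPS⇒Simplifies : ∀ {X} {N M : Net X} → CPS N M → Simplifies N M
CPS⇒Simplifies (start _) = Simplifies-refl
CPS⇒Simplifies (stepV c v _ _ _ _) =
  Simplifies-trans (CPS⇒Simplifies c) (Simplifies-Dv (proj₁ (CPS⇒IsDC c)) v)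
CPS⇒Simplifies (stepA c _ _ red _) =
  Simplifies-trans (CPS⇒Simplifies c) (Simplifies-Darc (proj₁ (CPS⇒IsDC c)) red)

Simplifies⇒cl⇔ : ∀ {X} {N M : Net X} → Simplifies N M → IsXNetwork M
               → ∀ v → vert M v → ∀ x → cl N v x ⇔ cl M v x
Simplifies⇒cl⇔ {N = N} {M} NM M-net v v∈ x =
  subst (λ ℓ → Path N v ℓ ⇔ cl M v x) (leaf≡ NM x)
        (path⇔ NM v (leaf M x) v∈ (proj₁ (leaf-leaf M-net x)))

theorem5p2 : {X : Set} (N N' : Net X) → IsDC N → CPS N N'
    → IsDC N'
      × Σ (ℕ → ℕ) λ φ →
          (∀ v → vert N' v → vert N (φ v) × (∀ x → cl N (φ v) x ⇔ cl N' v x)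
              × (∀ u → vert N u → (∀ x → cl N u x ⇔ cl N' v x) → u ≡ φ v))
          × (∀ u v → arc N' u v → Path N (φ u) (φ v))
          × (∀ u v → vert N' u → vert N' v → Path N (φ u) (φ v) → Path N' u v)
          × (∀ u w → vert N' u → vert N' w → ((_<ₙ_ N (φ u) (φ w)) ⇔ (_<ₙ_ N' u w)))
theorem5p2 N N' (_ , N-dc) c =
  N'-dc , (λ v → v) ,
  (λ v v∈ → vert⊆ NN' v v∈ , cl⇔ v v∈ ,
     λ u u∈ u~v → N-dc u v u∈ (vert⊆ NN' v v∈)
                    (λ x → ⇔-sym (cl⇔ v v∈ x) ⇔-∘ u~v x)) ,
  (λ u v e → let (u∈ , v∈) = arc-vert N'-net u v e in from (path⇔ NN' u v u∈ v∈) (e ◅ ε)) ,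
  (λ u v u∈ v∈ → to (path⇔ NN' u v u∈ v∈)) ,
  (λ u w u∈ w∈ → mk⇔ (λ (p , u≢w) → to (path⇔ NN' u w u∈ w∈) p , u≢w)
                      (λ (p , u≢w) → from (path⇔ NN' u w u∈ w∈) p , u≢w))
  where
    N'-dc : IsDC N'
    N'-dc = CPS⇒IsDC c

    N'-net : IsXNetwork N'
    N'-net = proj₁ N'-dc

    NN' : Simplifies N N'
    NN' = CPS⇒Simplifies c

    cl⇔ : ∀ v → vert N' v → ∀ x → cl N v x ⇔ cl N' v x
    cl⇔ = Simplifies⇒cl⇔ NN' N'-net
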